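{- Let $k\ge2$ and let $A=\{a_n\}$ be an infinite set of natural numbers (enumerated increasingly) such that $a_n=o(n^{k/(k-1)})$. Then $R_k(A)=\{x\in\mathbb{N}\mid |A\cap(A+x)|\ge k\}$ is a $\Delta_f$-set, i.e. for every $h$ there is a finite set $Z$ with $|Z|=h$ and $\Delta(Z)\subseteq R_k(A)$.
   Context: Natural numbers are positive integers; $A+x=\{a+x\mid a\in A\}$; $a_n=o(g(n))$ means $a_n/g(n)\to0$. For $X\subseteq\mathbb{N}$, $\Delta(X)=\{x'-x\mid x,x'\in X,\ x'>x\}$. A set $S\subseteq\mathbb{N}$ is a $\Delta_f$-set if for every $h$ there exists $X$ with $|X|=h$ and $\Delta(X)\subseteq S$. -}

module Defs where

open import Data.Nat using (ℕ; zero; suc; _+_; _*_; _∸_; _^_; _≤_; _<_)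
open import Data.Fin using (Fin)
open import Data.Product using (Σ; ∃; _×_)
open import Function.Definitions using (Injective)
open import Relation.Binary.PropositionalEquality using (_≡_)

-- An infinite set A of natural numbers (positive integers), enumerated
-- increasingly: a 0 < a 1 < a 2 < ..., i.e. a i is the paper's a_{i+1}.
StrictlyIncreasing : (ℕ → ℕ) → Set
StrictlyIncreasing a = ∀ i → a i < a (suc i)

_∈A[_] : ℕ → (ℕ → ℕ) → Set
y ∈A[ a ] = ∃ λ i → a i ≡ y

-- a_n = o(n^{k/(k-1)}) for k ≥ 2, stated without reals:
-- a_n / n^{k/(k-1)} → 0  ⇔  a_n^{k-1} / n^k → 0, i.e.
-- for every m ≥ 1 there is N such that for all n ≥ N, m · a_n^{k-1} ≤ n^k.
-- (Index: a i is a_{i+1}, so n = suc i.)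
LittleO : ℕ → (ℕ → ℕ) → Set
LittleO k a = ∀ (m : ℕ) → 1 ≤ m → ∃ λ N → ∀ i → N ≤ i →
  m * (a i ^ (k ∸ 1)) ≤ (suc i) ^ k

-- x ∈ R_k(A) : x is a natural number (x ≥ 1) and |A ∩ (A + x)| ≥ k,
-- i.e. there are k distinct elements y (given injectively by g) with
-- y ∈ A and y ∈ A + x (y = a' + x with a' ∈ A).
R : ℕ → (ℕ → ℕ) → ℕ → Set
R k a x = 1 ≤ x × Σ (Fin k → ℕ) λ g → Injective _≡_ _≡_ g ×
  (∀ j → (g j ∈A[ a ]) × (∃ λ y → (y ∈A[ a ]) × (y + x ≡ g j)))

ΔSubset : ∀ {h} → (Fin h → ℕ) → (ℕ → Set) → Set
ΔSubset z S = ∀ i j → z i < z j → S (z j ∸ z i)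

IsΔf : (ℕ → Set) → Set
IsΔf S = ∀ (h : ℕ) → Σ (Fin h → ℕ) λ z → Injective _≡_ _≡_ z ×
  (∀ i → 1 ≤ z i) × ΔSubset z S

-- Cut the first kM terms of A into k consecutive blocks B₀, …, B_{k-1} of M terms and
-- let A' be the largest of them. Each t ∈ B₀ lies below every later block and within A' of it,
-- so double counting the pairs (t, v) with v < A' and t + v ∈ B_l yields a shift v that moves
-- at least a fraction M / A' of any T ⊆ B₀ into B_l. Refining T block by block leaves
-- T ⊆ B₀ with |T| ≥ M^k / A'^{k-1} and shifts d_l with T + d_l ⊆ B_l, and a_n = o(n^{k/(k-1)})
-- makes |T| > h once M is large. For z < z′ in T the k numbers z′ + d_l lie in distinct
-- blocks and z′ + d_l − (z′ − z) = z + d_l ∈ A, hence z′ − z ∈ R_k(A).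
module Submission where

open import Defs
open import Data.Nat using (ℕ; _≤_; _<_; zero; suc; _+_; _*_; _∸_; _^_; z≤n; s≤s; >-nonZero)
open import Data.Nat.Properties
open import Data.Nat.ListAction using (sum)
open import Algebra.Properties.CommutativeSemigroup +-commutativeSemigroup
  using () renaming (x∙yz≈y∙xz to m+[n+o]≡n+[m+o]; xy∙z≈xz∙y to [m+n]+o≡[m+o]+n)
open import Algebra.Properties.CommutativeSemigroup *-commutativeSemigroup
  using () renaming ( x∙yz≈y∙xz to m*[n*o]≡n*[m*o]; xy∙z≈xz∙y to [m*n]*o≡[m*o]*n
                    ; x∙yz≈yx∙z to m*[n*o]≡[n*m]*o; xy∙z≈y∙xz to [m*n]*o≡n*[m*o])
open import Data.Fin using (Fin; zero; suc; toℕ; inject≤)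
open import Data.Fin.Properties using (toℕ-injective; toℕ<n; inject≤-injective; injective⇒≤)
open import Data.List using (List; []; _∷_; length; filter; map; upTo; applyUpTo; lookup)
open import Data.List.Properties using (length-upTo; length-applyUpTo; length-map)
open import Data.List.Membership.Propositional using (_∈_)
open import Data.List.Membership.DecPropositional _≟_ using (_∈?_)
open import Data.List.Membership.Propositional.Properties
  using (∈-lookup; ∈-map⁺; ∈-filter⁺; ∈-filter⁻; ∈-upTo⁺; ∈-applyUpTo⁻)
open import Data.List.Relation.Binary.Subset.Propositional using (_⊆_)
open import Data.List.Relation.Unary.Any using (here; there; index)
open import Data.List.Relation.Unary.Any.Properties using (lookup-index)
import Data.List.Relation.Unary.All as All
open import Data.List.Relation.Unary.AllPairs using (_∷_)
open import Data.List.Relation.Unary.Unique.Propositional using (Unique)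
import Data.List.Relation.Unary.Unique.Propositional.Properties as Unique
open import Data.Product using (Σ; ∃; _×_; _,_; proj₁; proj₂)
open import Data.Sum using (inj₁; inj₂)
open import Data.Empty using (⊥-elim)
open import Function using (_∘_)
open import Function.Definitions using (Injective)
open import Relation.Nullary using (Dec; yes; no)
open import Relation.Binary using (tri<; tri≈; tri>)
open import Relation.Binary.PropositionalEquality

lookup-injective : ∀ {A : Set} {xs : List A} → Unique xs → Injective _≡_ _≡_ (lookup xs)
lookup-injective {xs = x ∷ xs} (_ ∷ _)         {zero}  {zero}  _  = refl
lookup-injective {xs = x ∷ xs} (x∉xs ∷ _)      {zero}  {suc j} eq = ⊥-elim (All.lookup x∉xs (∈-lookup j) eq)
lookup-injective {xs = x ∷ xs} (x∉xs ∷ _)      {suc i} {zero}  eq = ⊥-elim (All.lookup x∉xs (∈-lookup i) (sym eq))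
lookup-injective {xs = x ∷ xs} (_ ∷ xs-unique) {suc i} {suc j} eq = cong suc (lookup-injective xs-unique eq)

length-≤-⊆ : ∀ {A : Set} {xs ys : List A} → Unique xs → xs ⊆ ys → length xs ≤ length ys
length-≤-⊆ {xs = xs} {ys} xs-unique xs⊆ys = injective⇒≤ position-injective
  where
  position : Fin (length xs) → Fin (length ys)
  position i = index (xs⊆ys (∈-lookup i))

  position-injective : Injective _≡_ _≡_ position
  position-injective {i} {j} eq = lookup-injective xs-unique (begin
    lookup xs i            ≡⟨ lookup-index (xs⊆ys (∈-lookup i)) ⟩
    lookup ys (position i) ≡⟨ cong (lookup ys) eq ⟩
    lookup ys (position j) ≡⟨ lookup-index (xs⊆ys (∈-lookup j)) ⟨
    lookup xs j            ∎)
    where open ≡-Reasoning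

injection-into-unique : ∀ {A : Set} {h} (xs : List A) → Unique xs → h ≤ length xs →
  Σ (Fin h → A) λ z → Injective _≡_ _≡_ z × (∀ i → z i ∈ xs)
injection-into-unique xs xs-unique h≤∣xs∣ =
  (λ i → lookup xs (inject≤ i h≤∣xs∣)) ,
  (λ eq → inject≤-injective _ _ _ _ (lookup-injective xs-unique eq)) ,
  (λ i → ∈-lookup _)

∃-sum-map≤length* : ∀ {A : Set} (f : A → ℕ) (xs : List A) → A →
  ∃ λ x → sum (map f xs) ≤ length xs * f x
∃-sum-map≤length* f []       x₀ = x₀ , z≤n
∃-sum-map≤length* f (x ∷ xs) x₀ with ∃-sum-map≤length* f xs x₀
... | y , sum≤ with f x ≤? f y
...   | yes fx≤fy = y , +-mono-≤ fx≤fy sum≤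
...   | no  fx≰fy =
    x , +-monoʳ-≤ (f x) (≤-trans sum≤ (*-monoʳ-≤ (length xs) (<⇒≤ (≰⇒> fx≰fy))))

length*≤sum-map : ∀ {A : Set} (f : A → ℕ) {m} (xs : List A) → (∀ {x} → x ∈ xs → m ≤ f x) →
  length xs * m ≤ sum (map f xs)
length*≤sum-map f []       m≤f = z≤n
length*≤sum-map f (x ∷ xs) m≤f = +-mono-≤ (m≤f (here refl)) (length*≤sum-map f xs (m≤f ∘ there))

module DoubleCounting {A B : Set} {Q : A → B → Set} (Q? : ∀ x y → Dec (Q x y)) where

  row : A → List B → ℕ
  row x ys = length (filter (Q? x) ys)

  column : B → List A → ℕ
  column y xs = length (filter (λ x → Q? x y) xs)

  sum-rows-∷ : ∀ y ys xs →
    sum (map (λ x → row x (y ∷ ys)) xs) ≡ column y xs + sum (map (λ x → row x ys) xs)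
  sum-rows-∷ y ys []       = refl
  sum-rows-∷ y ys (x ∷ xs) with Q? x y
  ... | yes _ = cong suc (trans (cong (row x ys +_) (sum-rows-∷ y ys xs))
                                (m+[n+o]≡n+[m+o] (row x ys) (column y xs) _))
  ... | no  _ = trans (cong (row x ys +_) (sum-rows-∷ y ys xs))
                      (m+[n+o]≡n+[m+o] (row x ys) (column y xs) _)

  double-counting : ∀ xs ys → sum (map (λ x → row x ys) xs) ≡ sum (map (λ y → column y xs) ys)
  double-counting []       []       = refl
  double-counting (x ∷ xs) []       = double-counting xs []
  double-counting xs       (y ∷ ys) =
    trans (sum-rows-∷ y ys xs) (cong (column y xs +_) (double-counting xs ys))

shift-average : ∀ A (T B : List ℕ) → Unique B → (∀ {t b} → t ∈ T → b ∈ B → t ≤ b × b ∸ t < A) →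
  ∃ λ v → length T * length B ≤ A * length (filter (λ t → t + v ∈? B) T)
shift-average A T B B-unique B-close = v , averaging-bound
  where
  open DoubleCounting (λ v t → t + v ∈? B)

  shifts-into-B : ∀ {t} → t ∈ T → length B ≤ column t (upTo A)
  shifts-into-B {t} t∈T = begin
    length B                  ≤⟨ length-≤-⊆ B-unique B⊆t+shifts ⟩
    length (map (t +_) shifts) ≡⟨ length-map (t +_) shifts ⟩
    length shifts             ∎
    where
    open ≤-Reasoning
    shifts = filter (λ v → t + v ∈? B) (upTo A)

    B⊆t+shifts : B ⊆ map (t +_) shifts
    B⊆t+shifts {b} b∈B with t≤b , b∸t<A ← B-close t∈T b∈B =
      subst (_∈ map (t +_) shifts) (m+[n∸m]≡n t≤b)
        (∈-map⁺ (t +_) (∈-filter⁺ (λ v → t + v ∈? B) (∈-upTo⁺ b∸t<A)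
                                   (subst (_∈ B) (sym (m+[n∸m]≡n t≤b)) b∈B)))

  averaged : ∃ λ v → sum (map (λ v → row v T) (upTo A)) ≤ length (upTo A) * row v T
  averaged = ∃-sum-map≤length* (λ v → row v T) (upTo A) 0

  v = proj₁ averaged

  averaging-bound : length T * length B ≤ A * row v T
  averaging-bound = begin
    length T * length B                   ≤⟨ length*≤sum-map (λ t → column t (upTo A)) T shifts-into-B ⟩
    sum (map (λ t → column t (upTo A)) T) ≡⟨ double-counting (upTo A) T ⟨
    sum (map (λ v → row v T) (upTo A))    ≤⟨ proj₂ averaged ⟩
    length (upTo A) * row v T             ≡⟨ cong (_* row v T) (length-upTo A) ⟩
    A * row v T                           ∎
    where open ≤-Reasoning

record CommonTranslate (A M : ℕ) {n} (T₀ : List ℕ) (B : Fin n → List ℕ) : Set where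
  field
    T         : List ℕ
    T-unique  : Unique T
    T⊆T₀      : T ⊆ T₀
    T-large   : length T₀ * M ^ n ≤ length T * A ^ n
    shift     : Fin n → ℕ
    T+shift⊆B : ∀ i {t} → t ∈ T → t + shift i ∈ B i

common-translate : ∀ {A M} n (T₀ : List ℕ) (B : Fin n → List ℕ) → Unique T₀ →
  (∀ i → Unique (B i)) → (∀ i → M ≤ length (B i)) →
  (∀ i {t b} → t ∈ T₀ → b ∈ B i → t ≤ b × b ∸ t < A) → CommonTranslate A M T₀ B
common-translate zero T₀ B T₀-unique _ _ _ = record
  { T = T₀ ; T-unique = T₀-unique ; T⊆T₀ = λ t∈T₀ → t∈T₀ ; T-large = ≤-refl
  ; shift = λ () ; T+shift⊆B = λ () }
common-translate {A} {M} (suc n) T₀ B T₀-unique B-unique B-large B-close = record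
  { T = T′ ; T-unique = Unique.filter⁺ (λ t → t + v ∈? B zero) T-unique ; T⊆T₀ = T⊆T₀ ∘ T′⊆T
  ; T-large = T′-large ; shift = shift′ ; T+shift⊆B = T′+shift′⊆B }
  where
  open CommonTranslate
    (common-translate n T₀ (B ∘ suc) T₀-unique (B-unique ∘ suc) (B-large ∘ suc) (B-close ∘ suc))

  averaged = shift-average A T (B zero) (B-unique zero) (B-close zero ∘ T⊆T₀)
  v = proj₁ averaged
  T′ = filter (λ t → t + v ∈? B zero) T

  ∈-T′⁻ : ∀ {t} → t ∈ T′ → t ∈ T × t + v ∈ B zero
  ∈-T′⁻ = ∈-filter⁻ (λ t → t + v ∈? B zero) {xs = T}

  T′⊆T : T′ ⊆ T
  T′⊆T = proj₁ ∘ ∈-T′⁻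

  shift′ : Fin (suc n) → ℕ
  shift′ zero    = v
  shift′ (suc i) = shift i

  T′+shift′⊆B : ∀ i {t} → t ∈ T′ → t + shift′ i ∈ B i
  T′+shift′⊆B zero    = proj₂ ∘ ∈-T′⁻
  T′+shift′⊆B (suc i) = T+shift⊆B i ∘ T′⊆T

  T′-large : length T₀ * M ^ suc n ≤ length T′ * A ^ suc n
  T′-large = begin
    length T₀ * (M * M ^ n)             ≡⟨ m*[n*o]≡n*[m*o] (length T₀) M (M ^ n) ⟩
    M * (length T₀ * M ^ n)             ≤⟨ *-monoʳ-≤ M T-large ⟩
    M * (length T * A ^ n)              ≡⟨ m*[n*o]≡[n*m]*o M (length T) (A ^ n) ⟩
    length T * M * A ^ n                ≤⟨ *-monoˡ-≤ (A ^ n) (*-monoʳ-≤ (length T) (B-large zero)) ⟩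
    length T * length (B zero) * A ^ n  ≤⟨ *-monoˡ-≤ (A ^ n) (proj₂ averaged) ⟩
    A * length T′ * A ^ n               ≡⟨ [m*n]*o≡n*[m*o] A (length T′) (A ^ n) ⟩
    length T′ * (A * A ^ n)             ∎
    where open ≤-Reasoning

R-difference : ∀ {k} (a : ℕ → ℕ) (B : Fin k → List ℕ) →
  (∀ i {x} → x ∈ B i → x ∈A[ a ]) → (∀ {i j x} → x ∈ B i → x ∈ B j → i ≡ j) →
  (d : Fin k → ℕ) → ∀ {z z′} → z < z′ → (∀ i → z + d i ∈ B i) → (∀ i → z′ + d i ∈ B i) →
  R k a (z′ ∸ z)
R-difference a B B⊆A B-disjoint d {z} {z′} z<z′ z+d∈B z′+d∈B =
  m<n⇒0<n∸m z<z′ , (λ i → z′ + d i) , translate-injective ,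
  λ i → B⊆A i (z′+d∈B i) , z + d i , B⊆A i (z+d∈B i) , translate i
  where
  translate-injective : Injective _≡_ _≡_ (λ i → z′ + d i)
  translate-injective {i} {j} eq = B-disjoint (z′+d∈B i) (subst (_∈ B j) (sym eq) (z′+d∈B j))

  translate : ∀ i → z + d i + (z′ ∸ z) ≡ z′ + d i
  translate i = trans ([m+n]+o≡[m+o]+n z (d i) (z′ ∸ z)) (cong (_+ d i) (m+[n∸m]≡n (<⇒≤ z<z′)))

m<n⇒m*o+p<n*o+q : ∀ {m n o p} q → m < n → p < o → m * o + p < n * o + q
m<n⇒m*o+p<n*o+q {m} {n} {o} {p} q m<n p<o = begin-strict
  m * o + p  <⟨ +-monoʳ-< (m * o) p<o ⟩
  m * o + o  ≡⟨ +-comm (m * o) o ⟩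
  suc m * o  ≤⟨ *-monoˡ-≤ o m<n ⟩
  n * o      ≤⟨ m≤m+n (n * o) q ⟩
  n * o + q  ∎
  where open ≤-Reasoning

m*o+p≡n*o+q⇒m≡n : ∀ {m n o p q} → p < o → q < o → m * o + p ≡ n * o + q → m ≡ n
m*o+p≡n*o+q⇒m≡n {m} {n} p<o q<o eq with <-cmp m n
... | tri< m<n _ _ = ⊥-elim (<⇒≢ (m<n⇒m*o+p<n*o+q _ m<n p<o) eq)
... | tri≈ _ m≡n _ = m≡n
... | tri> _ _ n<m = ⊥-elim (<⇒≢ (m<n⇒m*o+p<n*o+q _ n<m q<o) (sym eq))

^-distribʳ-* : ∀ m n o → (m * n) ^ o ≡ m ^ o * n ^ o
^-distribʳ-* m n zero    = refl
^-distribʳ-* m n (suc o) =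
  trans (cong (m * n *_) (^-distribʳ-* m n o)) ([m*n]*[o*p]≡[m*o]*[n*p] m n (m ^ o) (n ^ o))

module StrictlyIncreasingSequence {a : ℕ → ℕ} (a-inc : StrictlyIncreasing a) where

  a-mono-< : ∀ {i j} → i < j → a i < a j
  a-mono-< {i} {suc j} (s≤s i≤j) with m≤n⇒m<n∨m≡n i≤j
  ... | inj₁ i<j  = <-trans (a-mono-< i<j) (a-inc j)
  ... | inj₂ refl = a-inc i

  a-mono-≤ : ∀ {i j} → i ≤ j → a i ≤ a j
  a-mono-≤ i≤j with m≤n⇒m<n∨m≡n i≤j
  ... | inj₁ i<j  = <⇒≤ (a-mono-< i<j)
  ... | inj₂ refl = ≤-refl

  a-injective : Injective _≡_ _≡_ a
  a-injective {i} {j} eq with <-cmp i j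
  ... | tri< i<j _ _ = ⊥-elim (<⇒≢ (a-mono-< i<j) eq)
  ... | tri≈ _ i≡j _ = i≡j
  ... | tri> _ _ j<i = ⊥-elim (<⇒≢ (a-mono-< j<i) (sym eq))

  ∈A⇒positive : 1 ≤ a 0 → ∀ {x} → x ∈A[ a ] → 1 ≤ x
  ∈A⇒positive a₀≥1 (i , refl) = ≤-trans a₀≥1 (a-mono-≤ z≤n)

  module Blocks (M : ℕ) where

    block : ℕ → List ℕ
    block l = applyUpTo (λ r → a (l * M + r)) M

    block-unique : ∀ l → Unique (block l)
    block-unique l = Unique.applyUpTo⁺₁ _ M (λ r<r′ _ → <⇒≢ (a-mono-< (+-monoʳ-< (l * M) r<r′)))

    length-block : ∀ l → length (block l) ≡ M
    length-block l = length-applyUpTo _ M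

    ∈-block⁻ : ∀ l {x} → x ∈ block l → ∃ λ r → r < M × x ≡ a (l * M + r)
    ∈-block⁻ l = ∈-applyUpTo⁻ (λ r → a (l * M + r))

    block⊆A : ∀ {l x} → x ∈ block l → x ∈A[ a ]
    block⊆A {l} x∈block with r , _ , x≡ ← ∈-block⁻ l x∈block = _ , sym x≡

    block-disjoint : ∀ {l l′ x} → x ∈ block l → x ∈ block l′ → l ≡ l′
    block-disjoint {l} {l′} x∈block x∈block′
      with r , r<M , x≡ ← ∈-block⁻ l x∈block | r′ , r′<M , x≡′ ← ∈-block⁻ l′ x∈block′ =
      m*o+p≡n*o+q⇒m≡n r<M r′<M (a-injective (trans (sym x≡) x≡′))

    block-close : ∀ {k A l t b} → 1 ≤ a 0 → (∀ i → i < k * M → a i ≤ A) → suc l < k →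
      t ∈ block 0 → b ∈ block (suc l) → t ≤ b × b ∸ t < A
    block-close {k} {A} {l} a₀≥1 a≤A 1+l<k t∈block₀ b∈block
      with r , r<M , refl ← ∈-block⁻ 0 t∈block₀ | r′ , r′<M , refl ← ∈-block⁻ (suc l) b∈block =
      <⇒≤ t<b , (begin-strict
        b ∸ t  <⟨ ∸-monoʳ-< {o = 0} t≥1 (<⇒≤ t<b) ⟩
        b      ≤⟨ a≤A (suc l * M + r′) index<kM ⟩
        A      ∎)
      where
      open ≤-Reasoning
      t = a r
      b = a (suc l * M + r′)
      t<b : t < b
      t<b = a-mono-< (m<n⇒m*o+p<n*o+q {0} {suc l} r′ (s≤s z≤n) r<M)
      index<kM : suc l * M + r′ < k * M
      index<kM = subst (suc l * M + r′ <_) (+-identityʳ (k * M)) (m<n⇒m*o+p<n*o+q 0 1+l<k r′<M)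
      t≥1 : 1 ≤ t
      t≥1 = ∈A⇒positive a₀≥1 (r , refl)

    block-translate : ∀ {n A} → 1 ≤ a 0 → (∀ i → i < suc n * M → a i ≤ A) →
      CommonTranslate A M (block 0) (λ (i : Fin n) → block (suc (toℕ i)))
    block-translate {n} a₀≥1 a≤A =
      common-translate n (block 0) _ (block-unique 0) (λ i → block-unique (suc (toℕ i)))
        (λ i → ≤-reflexive (sym (length-block (suc (toℕ i)))))
        (λ i → block-close a₀≥1 a≤A (toℕ<n (suc i)))


    module _ {n A} (translate : CommonTranslate A M (block 0) (λ (i : Fin n) → block (suc (toℕ i)))) where
      open CommonTranslate translate

      Δ-T⊆R : ∀ {z z′} → z ∈ T → z′ ∈ T → z < z′ → R (suc n) a (z′ ∸ z)
      Δ-T⊆R z∈T z′∈T z<z′ =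
        R-difference a (block ∘ toℕ) (λ i → block⊆A {toℕ i}) block∘toℕ-disjoint shift₀ z<z′
          (T+shift₀⊆block z∈T) (T+shift₀⊆block z′∈T)
        where
        block∘toℕ-disjoint : ∀ {i j x} → x ∈ block (toℕ i) → x ∈ block (toℕ j) → i ≡ j
        block∘toℕ-disjoint {i} {j} x∈blockᵢ x∈blockⱼ = toℕ-injective (block-disjoint x∈blockᵢ x∈blockⱼ)

        shift₀ : Fin (suc n) → ℕ
        shift₀ zero    = 0
        shift₀ (suc i) = shift i

        T+shift₀⊆block : ∀ {t} → t ∈ T → ∀ i → t + shift₀ i ∈ block (toℕ i)
        T+shift₀⊆block t∈T zero    = subst (_∈ block 0) (sym (+-identityʳ _)) (T⊆T₀ t∈T)
        T+shift₀⊆block t∈T (suc i) = T+shift⊆B i t∈T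

little-o-window : ∀ {k′ a} → LittleO (suc k′) a → ∀ c → 1 ≤ c →
  ∃ λ N → c * a (N + k′ * suc N) ^ k′ ≤ suc N ^ suc k′
little-o-window {k′} {a} little-o c c≥1
  with N , large ← little-o (c * suc k′ ^ suc k′) (*-mono-≤ c≥1 (m^n>0 (suc k′) (suc k′))) =
  N , *-cancelʳ-≤ _ _ (k ^ k) {{m^n≢0 k k}} (begin
    c * aᵢ ^ k′ * k ^ k  ≡⟨ [m*n]*o≡[m*o]*n c (aᵢ ^ k′) (k ^ k) ⟩
    c * k ^ k * aᵢ ^ k′  ≤⟨ large i (m≤m+n N (k′ * suc N)) ⟩
    (k * suc N) ^ k      ≡⟨ ^-distribʳ-* k (suc N) k ⟩
    k ^ k * suc N ^ k    ≡⟨ *-comm (k ^ k) (suc N ^ k) ⟩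
    suc N ^ k * k ^ k    ∎)
  where
  open ≤-Reasoning
  k = suc k′
  i = N + k′ * suc N
  aᵢ = a i

theorem3p3 : (k : ℕ) → 2 ≤ k → (a : ℕ → ℕ) → 1 ≤ a 0 → StrictlyIncreasing a →
    LittleO k a → IsΔf (R k a)
theorem3p3 (suc zero) (s≤s ())
theorem3p3 (suc (suc n)) _ a a₀≥1 a-inc little-o h =
  z , z-injective , (λ i → ∈A⇒positive a₀≥1 (block⊆A {0} (T⊆T₀ (z∈T i)))) ,
  λ i j → Δ-T⊆R translate (z∈T i) (z∈T j)
  where
  open StrictlyIncreasingSequence a-inc
  window = little-o-window {suc n} {a} little-o (suc h) (s≤s z≤n)
  N = proj₁ window
  M = suc N
  -- A = a (kM - 1), the largest element of the k blocks
  A = a (N + suc n * M)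
  open Blocks M

  translate = block-translate {suc n} {A} a₀≥1 (λ { i (s≤s i≤) → a-mono-≤ i≤ })
  open CommonTranslate translate

  T-long : suc h ≤ length T
  T-long = *-cancelʳ-≤ (suc h) (length T) (A ^ suc n) {{m^n≢0 A (suc n) {{>-nonZero A≥1}}}}
    (≤-trans (proj₂ window) (subst (λ L → L * M ^ suc n ≤ length T * A ^ suc n) (length-block 0) T-large))
    where
    A≥1 : 1 ≤ A
    A≥1 = ∈A⇒positive a₀≥1 (_ , refl)

  z-data = injection-into-unique T T-unique (≤-trans (n≤1+n h) T-long)
  z = proj₁ z-data
  z-injective = proj₁ (proj₂ z-data)
  z∈T = proj₂ (proj₂ z-data)
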